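{- Let $G$ be a finite undirected graph and let $F \subseteq E(G)$ be a set of edges. Then \[ \max \{|F \cap E(\mathcal{C})| \colon \mathcal{C} \text{ is a collection of edge-disjoint cycles of } G \} \;\ge\;\min \{|Y| \colon Y \subseteq E(G) \text{ hits all $F$-cycles in } G \}. \]
   Context: An $F$-cycle is a cycle of $G$ that contains at least one edge of $F$. For a collection $\mathcal{C}$ of cycles, $E(\mathcal{C})$ denotes the set of all edges contained in some cycle of $\mathcal{C}$. A set $Y$ of edges hits a cycle if the cycle contains an edge of $Y$. -}

module Defs where

open import Data.Nat using (ℕ; suc; _≤_; _≥_)
open import Data.Nat.DivMod using (_mod_)
open import Data.Fin using (Fin; toℕ)
open import Data.Fin.Subset using (Subset; _∈_; _∉_; _∩_; _∪_; ⁅_⁆; ⋃; ∣_∣; Nonempty)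
open import Data.Product using (_×_; _,_; proj₁; proj₂)
open import Data.Sum using (_⊎_)
open import Data.List using (List; map)
open import Data.List.Relation.Unary.AllPairs using (AllPairs)
open import Data.Vec.Functional using (toList)
open import Relation.Binary.PropositionalEquality using (_≡_; _≢_)
open import Function.Definitions using (Injective)

-- A finite undirected graph with vertex set Fin n and edge set Fin m;
-- each edge has two endpoints (stored as an ordered pair, read unordered).
record Graph : Set where
  field
    n    : ℕ
    m    : ℕ
    ends : Fin m → Fin n × Fin n

open Graph public

Joins : (G : Graph) → Fin (m G) → Fin (n G) → Fin (n G) → Set
Joins G e u v = ends G e ≡ (u , v) ⊎ ends G e ≡ (v , u)

Simple : Graph → Set
Simple G =
  (∀ e → proj₁ (ends G e) ≢ proj₂ (ends G e)) ×
  (∀ e e′ → Joins G e′ (proj₁ (ends G e)) (proj₂ (ends G e)) → e ≡ e′)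

next : ∀ {k} → Fin (suc k) → Fin (suc k)
next {k} i = suc (toℕ i) mod (suc k)

-- A cycle v₀ e₀ v₁ e₁ … v_k e_k v₀ of length suc k ≥ 3 with distinct vertices,
-- where edge e_i joins v_i and v_{i+1 mod (k+1)}.
record Cycle (G : Graph) : Set where
  field
    k       : ℕ
    long    : 3 ≤ suc k
    vtx     : Fin (suc k) → Fin (n G)
    vtx-inj : Injective _≡_ _≡_ vtx
    edge    : Fin (suc k) → Fin (m G)
    joins   : ∀ i → Joins G (edge i) (vtx i) (vtx (next i))

open Cycle public

cycleEdges : {G : Graph} → Cycle G → Subset (m G)
cycleEdges C = ⋃ (map ⁅_⁆ (toList (edge C)))

collEdges : {G : Graph} → List (Cycle G) → Subset (m G)
collEdges 𝒞 = ⋃ (map cycleEdges 𝒞)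

EdgeDisjoint : {G : Graph} → List (Cycle G) → Set
EdgeDisjoint = AllPairs (λ C D → ∀ e → e ∈ cycleEdges C → e ∉ cycleEdges D)

IsFCycle : {G : Graph} → Subset (m G) → Cycle G → Set
IsFCycle F C = Nonempty (F ∩ cycleEdges C)

Hits : {G : Graph} → Subset (m G) → Cycle G → Set
Hits Y C = Nonempty (Y ∩ cycleEdges C)

HitsAllFCycles : {G : Graph} → Subset (m G) → Subset (m G) → Set
HitsAllFCycles {G} F Y = (C : Cycle G) → IsFCycle F C → Hits Y C

{-# OPTIONS --safe #-}
module Submission where

-- Call a set of edges even if every vertex meets an even number of its edges. Choose an even
-- set H for which F ∩ H is maximal under inclusion and put Y = F ∩ H. An F-cycle C avoiding Y
-- would give the even set H Δ C with F ∩ H ⊂ F ∩ (H Δ C), so Y hits every F-cycle. In a simple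
-- graph a nonempty even set contains a cycle: a walk inside it can always leave a vertex along
-- an edge other than the one it arrived by, because that vertex has even degree, and the first
-- repeated vertex of such a walk closes up a cycle. Removing that cycle leaves an even set, so
-- H is covered by edge-disjoint cycles 𝒞, and then F ∩ E(𝒞) ⊇ Y.

open import Defs
open import Data.Nat using (ℕ; zero; suc; _≤_; _<_; _≥_; _∸_; _+_; _%_; z≤n; s≤s)
open import Data.Nat.Properties
  using (+-suc; m∸n+n≡m; +-monoˡ-<; ≤-pred; m≤n⇒m<n∨m≡n; <-irrefl; m<n⇒m<1+n; n<1+n; <-cmp)
open import Data.Nat.DivMod using (_mod_; m<n⇒m%n≡m; n%n≡0)
open import Data.Bool using (Bool; true; false; _∧_; _xor_)
import Data.Bool.Properties as Bool
open import Data.Bool.Properties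
  using (xor-assoc; xor-comm; xor-identityʳ; xor-same; ∧-distribʳ-xor; xor-∧-commutativeRing)
open import Data.Fin using (Fin; zero; suc; toℕ; fromℕ<)
open import Data.Fin.Properties
  using (_≟_; all?; any?; pigeonhole; toℕ-injective; toℕ-fromℕ<; toℕ<n; toℕ≤pred[n])
open import Data.Fin.Subset
  using (Subset; inside; outside; _∈_; _∉_; _⊆_; _⊂_; _⊄_; _⊃_; _∩_; _∪_; _─_; ⁅_⁆; ⋃; ⊥; ∣_∣;
         Empty; Nonempty)
open import Data.Fin.Subset.Properties
  using (drop-there; drop-∷-⊆; drop-∷-Empty; ∉⊥; x∈⁅x⁆; x∈⁅y⁆⇒x≡y; x∉⁅y⁆⇒x≢y; x∈p∩q⁺; x∈p∩q⁻;
         x∈p∪q⁺; x∈p∪q⁻; p─q⊆p; x∈p∧x∉q⇒x∈p─q; p∩q≢∅⇒p─q⊂p; p⊆q⇒∣p∣≤∣q∣;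
         _∈?_; _⊂?_; nonempty?; anySubset?)
open import Data.Fin.Subset.Induction using (⊂-wellFounded; ⊃-wellFounded)
open import Data.Vec using (_∷_; []; zipWith; here; there)
open import Data.List using (List; _∷_; []; map; tabulate; foldr)
open import Data.List.Properties using (tabulate-cong; map-tabulate)
open import Data.List.Membership.Propositional using () renaming (_∈_ to _∈ₗ_)
open import Data.List.Membership.Propositional.Properties using (∈-tabulate⁺; ∈-tabulate⁻)
import Data.List.Relation.Unary.Any as Any
open import Data.List.Relation.Unary.All as All using (All)
open import Data.List.Relation.Unary.All.Properties using (All¬⇒¬Any)
import Data.List.Relation.Unary.AllPairs as AllPairs
open import Data.List.Relation.Unary.Unique.Propositional using (Unique)
import Data.List.Relation.Unary.Unique.Propositional.Properties as Unique
open import Data.Product using (Σ; ∃; _×_; _,_; proj₁; proj₂)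
import Data.Product as Product
open import Data.Product.Properties using (,-injective)
open import Data.Sum using (_⊎_; inj₁; inj₂)
import Data.Sum as Sum
open import Function using (_∘_)
open import Function.Definitions using (Injective)
open import Induction.WellFounded using (Acc; acc)
open import Relation.Nullary using (¬_; contradiction; yes; no; does)
open import Relation.Nullary.Decidable using (dec-true; dec-false; _×-dec_)
open import Relation.Unary using (Decidable)
open import Relation.Binary.Definitions using (tri<; tri≈; tri>)
open import Relation.Binary.PropositionalEquality
open import Algebra.Bundles using (CommutativeRing)
open import Algebra.Properties.CommutativeSemigroup
  (CommutativeRing.+-commutativeSemigroup xor-∧-commutativeRing) using (interchange)

private
  variable
    N : ℕ
    x : Fin N
    p q : Subset N

infixl 6 _Δ_
_Δ_ : Subset N → Subset N → Subset N
_Δ_ = zipWith _xor_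

x∈pΔq⁺ˡ : x ∈ p → x ∉ q → x ∈ p Δ q
x∈pΔq⁺ˡ {q = outside ∷ q} here        x∉q = here
x∈pΔq⁺ˡ {q = inside  ∷ q} here        x∉q = contradiction here x∉q
x∈pΔq⁺ˡ {q = _       ∷ q} (there x∈p) x∉q = there (x∈pΔq⁺ˡ x∈p (x∉q ∘ there))

x∈pΔq⁺ʳ : x ∉ p → x ∈ q → x ∈ p Δ q
x∈pΔq⁺ʳ {p = outside ∷ p} x∉p here        = here
x∈pΔq⁺ʳ {p = inside  ∷ p} x∉p here        = contradiction here x∉p
x∈pΔq⁺ʳ {p = _       ∷ p} x∉p (there x∈q) = there (x∈pΔq⁺ʳ (x∉p ∘ there) x∈q)

p∪q≡pΔq : ∀ (p q : Subset N) → Empty (p ∩ q) → p ∪ q ≡ p Δ q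
p∪q≡pΔq []            []            _        = refl
p∪q≡pΔq (inside  ∷ p) (inside  ∷ q) disjoint = contradiction (zero , here) disjoint
p∪q≡pΔq (inside  ∷ p) (outside ∷ q) disjoint =
  cong (inside ∷_) (p∪q≡pΔq p q (drop-∷-Empty disjoint))
p∪q≡pΔq (outside ∷ p) (b       ∷ q) disjoint =
  cong (b ∷_) (p∪q≡pΔq p q (drop-∷-Empty disjoint))

p─q≡pΔq : ∀ (p q : Subset N) → q ⊆ p → p ─ q ≡ p Δ q
p─q≡pΔq []            []            _   = refl
p─q≡pΔq (inside  ∷ p) (outside ∷ q) q⊆p = cong (inside ∷_) (p─q≡pΔq p q (drop-∷-⊆ q⊆p))
p─q≡pΔq (outside ∷ p) (outside ∷ q) q⊆p = cong (outside ∷_) (p─q≡pΔq p q (drop-∷-⊆ q⊆p))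
p─q≡pΔq (inside  ∷ p) (inside  ∷ q) q⊆p = cong (outside ∷_) (p─q≡pΔq p q (drop-∷-⊆ q⊆p))
p─q≡pΔq (outside ∷ p) (inside  ∷ q) q⊆p = contradiction (q⊆p here) λ ()

x∈p─q⇒x∉q : ∀ (p q : Subset N) → x ∈ p ─ q → x ∉ q
x∈p─q⇒x∉q (_ ∷ p) (inside ∷ q) ()  here
x∈p─q⇒x∉q (_ ∷ p) (_      ∷ q) x∈p─q (there x∈q) = x∈p─q⇒x∉q p q (drop-there x∈p─q) x∈q

x∈⋃⁅xs⁆⁺ : ∀ {xs : List (Fin N)} → x ∈ₗ xs → x ∈ ⋃ (map ⁅_⁆ xs)
x∈⋃⁅xs⁆⁺ (Any.here refl) = x∈p∪q⁺ (inj₁ (x∈⁅x⁆ _))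
x∈⋃⁅xs⁆⁺ (Any.there x∈) = x∈p∪q⁺ (inj₂ (x∈⋃⁅xs⁆⁺ x∈))

x∈⋃⁅xs⁆⁻ : ∀ (xs : List (Fin N)) → x ∈ ⋃ (map ⁅_⁆ xs) → x ∈ₗ xs
x∈⋃⁅xs⁆⁻ []       x∈ = contradiction x∈ ∉⊥
x∈⋃⁅xs⁆⁻ (y ∷ xs) x∈ with x∈p∪q⁻ ⁅ y ⁆ _ x∈
... | inj₁ x∈⁅y⁆ = Any.here (x∈⁅y⁆⇒x≡y y x∈⁅y⁆)
... | inj₂ x∈ys  = Any.there (x∈⋃⁅xs⁆⁻ xs x∈ys)

p∩q⊆p∩r : ∀ (p q r : Subset N) → q ⊆ r → p ∩ q ⊆ p ∩ r
p∩q⊆p∩r p q r q⊆r x∈p∩q with x∈p , x∈q ← x∈p∩q⁻ p q x∈p∩q = x∈p∩q⁺ (x∈p , q⊆r x∈q)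

p∩q⊂p∩[qΔr] : ∀ (p q r : Subset N) → Empty ((p ∩ q) ∩ r) → Nonempty (p ∩ r) →
               p ∩ q ⊂ p ∩ (q Δ r)
p∩q⊂p∩[qΔr] p q r p∩q∩r-empty (y , y∈p∩r) =
  grow , y , x∈p∩q⁺ (y∈p , x∈pΔq⁺ʳ y∉q y∈r) , y∉q ∘ proj₂ ∘ x∈p∩q⁻ p q
  where
  y∈p : y ∈ p
  y∈p = proj₁ (x∈p∩q⁻ p r y∈p∩r)
  y∈r : y ∈ r
  y∈r = proj₂ (x∈p∩q⁻ p r y∈p∩r)
  y∉q : y ∉ q
  y∉q y∈q = p∩q∩r-empty (y , x∈p∩q⁺ (x∈p∩q⁺ (y∈p , y∈q) , y∈r))
  grow : p ∩ q ⊆ p ∩ (q Δ r)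
  grow x∈p∩q with x∈p , x∈q ← x∈p∩q⁻ p q x∈p∩q =
    x∈p∩q⁺ (x∈p , x∈pΔq⁺ˡ x∈q λ x∈r → p∩q∩r-empty (_ , x∈p∩q⁺ (x∈p∩q , x∈r)))

xorAll : List Bool → Bool
xorAll = foldr _xor_ false

parity : Subset N → (Fin N → Bool) → Bool
parity []      g = false
parity (s ∷ p) g = (s ∧ g zero) xor parity p (g ∘ suc)

parity-⊥ : ∀ (g : Fin N → Bool) → parity ⊥ g ≡ false
parity-⊥ {zero}  g = refl
parity-⊥ {suc N} g = parity-⊥ (g ∘ suc)

parity-⁅⁆ : ∀ (x : Fin N) g → parity ⁅ x ⁆ g ≡ g x
parity-⁅⁆ zero    g = trans (cong (g zero xor_) (parity-⊥ (g ∘ suc))) (xor-identityʳ (g zero))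
parity-⁅⁆ (suc x) g = parity-⁅⁆ x (g ∘ suc)

parity-Δ : ∀ (p q : Subset N) g → parity (p Δ q) g ≡ parity p g xor parity q g
parity-Δ []      []      g = refl
parity-Δ (a ∷ p) (b ∷ q) g = begin
  ((a xor b) ∧ g zero) xor parity (p Δ q) (g ∘ suc)
    ≡⟨ cong₂ _xor_ (∧-distribʳ-xor (g zero) a b) (parity-Δ p q (g ∘ suc)) ⟩
  ((a ∧ g zero) xor (b ∧ g zero)) xor (parity p (g ∘ suc) xor parity q (g ∘ suc))
    ≡⟨ interchange (a ∧ g zero) (b ∧ g zero) (parity p (g ∘ suc)) (parity q (g ∘ suc)) ⟩
  ((a ∧ g zero) xor parity p (g ∘ suc)) xor ((b ∧ g zero) xor parity q (g ∘ suc))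
    ∎
  where open ≡-Reasoning

parity-─ : ∀ (p q : Subset N) g → q ⊆ p → parity (p ─ q) g ≡ parity p g xor parity q g
parity-─ p q g q⊆p = trans (cong (λ r → parity r g) (p─q≡pΔq p q q⊆p)) (parity-Δ p q g)

parity-∪ : ∀ (p q : Subset N) g → Empty (p ∩ q) → parity (p ∪ q) g ≡ parity p g xor parity q g
parity-∪ p q g disjoint = trans (cong (λ r → parity r g) (p∪q≡pΔq p q disjoint)) (parity-Δ p q g)

parity-⋃⁅⁆ : ∀ (xs : List (Fin N)) g → Unique xs →
             parity (⋃ (map ⁅_⁆ xs)) g ≡ xorAll (map g xs)
parity-⋃⁅⁆ []       g AllPairs.[]                 = parity-⊥ g
parity-⋃⁅⁆ (x ∷ xs) g (x∉xs AllPairs.∷ xs-unique) = begin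
  parity (⁅ x ⁆ ∪ ⋃ (map ⁅_⁆ xs)) g
    ≡⟨ parity-∪ ⁅ x ⁆ _ g disjoint ⟩
  parity ⁅ x ⁆ g xor parity (⋃ (map ⁅_⁆ xs)) g
    ≡⟨ cong₂ _xor_ (parity-⁅⁆ x g) (parity-⋃⁅⁆ xs g xs-unique) ⟩
  g x xor xorAll (map g xs)
    ∎
  where
  open ≡-Reasoning
  disjoint : Empty (⁅ x ⁆ ∩ ⋃ (map ⁅_⁆ xs))
  disjoint (y , y∈) with y∈⁅x⁆ , y∈⋃ ← x∈p∩q⁻ ⁅ x ⁆ _ y∈ =
    All¬⇒¬Any x∉xs (subst (_∈ₗ xs) (x∈⁅y⁆⇒x≡y x y∈⁅x⁆) (x∈⋃⁅xs⁆⁻ xs y∈⋃))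

parity≡true⇒∃ : ∀ (p : Subset N) g → parity p g ≡ true → ∃ λ x → x ∈ p × g x ≡ true
parity≡true⇒∃ (inside ∷ p) g odd with g zero in g₀
... | true  = zero , here , g₀
... | false = Product.map suc (Product.map₁ there) (parity≡true⇒∃ p (g ∘ suc) odd)
parity≡true⇒∃ (outside ∷ p) g odd =
  Product.map suc (Product.map₁ there) (parity≡true⇒∃ p (g ∘ suc) odd)

toℕ-mod : ∀ {K} (t : Fin (suc K)) → toℕ t mod suc K ≡ t
toℕ-mod t = toℕ-injective (trans (toℕ-fromℕ< _) (m<n⇒m%n≡m (toℕ<n t)))

next-cases : ∀ {K} (t : Fin (suc K)) →
             (toℕ t < K × toℕ (next t) ≡ suc (toℕ t)) ⊎ (toℕ t ≡ K × toℕ (next t) ≡ 0)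
next-cases {K} t with m≤n⇒m<n∨m≡n (toℕ≤pred[n] t)
... | inj₁ t<K = inj₁ (t<K , trans (toℕ-fromℕ< _) (m<n⇒m%n≡m (s≤s t<K)))
... | inj₂ t≡K = inj₂ (t≡K , trans (toℕ-fromℕ< _)
                               (trans (cong (λ j → suc j % suc K) t≡K) (n%n≡0 (suc K))))

next²≢id : ∀ {K} → 2 ≤ K → (t : Fin (suc K)) → next (next t) ≢ t
next²≢id (s≤s (s≤s _)) t t⁺⁺≡t with next-cases t | next-cases (next t)
... | inj₁ (_ , t⁺) | inj₁ (_ , t⁺⁺) =
  <-irrefl (trans (sym (cong toℕ t⁺⁺≡t)) (trans t⁺⁺ (cong suc t⁺))) (m<n⇒m<1+n (n<1+n (toℕ t)))
... | inj₁ (_ , t⁺) | inj₂ (t⁺≡K , t⁺⁺≡0) =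
  contradiction (trans (sym t⁺≡K) (trans t⁺ (cong suc (trans (sym (cong toℕ t⁺⁺≡t)) t⁺⁺≡0)))) λ ()
... | inj₂ (t≡K , t⁺≡0) | inj₁ (_ , t⁺⁺) =
  contradiction (trans (sym t≡K) (trans (sym (cong toℕ t⁺⁺≡t)) (trans t⁺⁺ (cong suc t⁺≡0)))) λ ()
... | inj₂ (_ , t⁺≡0) | inj₂ (t⁺≡K , _) =
  contradiction (trans (sym t⁺≡K) t⁺≡0) λ ()

xorAll-telescope : ∀ N (a : ℕ → Bool) →
                   xorAll (tabulate {n = N} λ t → a (toℕ t) xor a (suc (toℕ t))) ≡ a 0 xor a N
xorAll-telescope zero    a = sym (xor-same (a 0))
xorAll-telescope (suc N) a = begin
  (a 0 xor a 1) xor xorAll (tabulate {n = N} λ t → a (suc (toℕ t)) xor a (suc (suc (toℕ t))))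
    ≡⟨ cong ((a 0 xor a 1) xor_) (xorAll-telescope N (a ∘ suc)) ⟩
  (a 0 xor a 1) xor (a 1 xor a (suc N))   ≡⟨ xor-assoc (a 0) (a 1) _ ⟩
  a 0 xor (a 1 xor (a 1 xor a (suc N)))   ≡⟨ cong (a 0 xor_) (xor-assoc (a 1) (a 1) _) ⟨
  a 0 xor ((a 1 xor a 1) xor a (suc N))   ≡⟨ cong (λ b → a 0 xor (b xor a (suc N))) (xor-same (a 1)) ⟩
  a 0 xor a (suc N)                       ∎
  where open ≡-Reasoning

xorAll-cyclic : ∀ {K} (a : Fin (suc K) → Bool) → xorAll (tabulate λ t → a t xor a (next t)) ≡ false
xorAll-cyclic {K} a = begin
  xorAll (tabulate λ t → a t xor a (next t))
    ≡⟨ cong xorAll (tabulate-cong λ t → cong (λ s → a s xor a (next t)) (toℕ-mod t)) ⟨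
  xorAll (tabulate {n = suc K} λ t → b (toℕ t) xor b (suc (toℕ t)))
    ≡⟨ xorAll-telescope (suc K) b ⟩
  a zero xor b (suc K)
    ≡⟨ cong (λ s → a zero xor a s) wrap ⟩
  a zero xor a zero
    ≡⟨ xor-same (a zero) ⟩
  false
    ∎
  where
  open ≡-Reasoning
  -- a (next t) is b (suc (toℕ t)) by definition of next, so only a t needs rewriting.
  b : ℕ → Bool
  b j = a (j mod suc K)
  wrap : suc K mod suc K ≡ zero
  wrap = toℕ-injective (trans (toℕ-fromℕ< _) (n%n≡0 (suc K)))

least-witness : ∀ {P : ℕ → Set} → Decidable P → ∀ {j} → P j →
                ∃ λ i → P i × (∀ {h} → h < i → ¬ P h)
least-witness P? {j} Pj with P? 0
... | yes P0 = 0 , P0 , λ ()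
least-witness P? {zero}  Pj | no ¬P0 = contradiction Pj ¬P0
least-witness P? {suc j} Pj | no ¬P0 with i , Pi , below ← least-witness (P? ∘ suc) Pj =
  suc i , Pi , λ { {zero} _ → ¬P0 ; {suc h} h<i → below (≤-pred h<i) }

distinct-below⇒injective : ∀ {A : Set} (f : ℕ → A) → (∀ {a b} → a < b → b < N → f a ≢ f b) →
                           Injective _≡_ _≡_ (λ (t : Fin N) → f (toℕ t))
distinct-below⇒injective f distinct {s} {t} fs≡ft with <-cmp (toℕ s) (toℕ t)
... | tri< s<t _ _ = contradiction fs≡ft (distinct s<t (toℕ<n t))
... | tri≈ _ s≡t _ = toℕ-injective s≡t
... | tri> _ _ t<s = contradiction (sym fs≡ft) (distinct t<s (toℕ<n s))

⊂-maximal : ∀ {M} {P : Subset N → Set} (f : Subset N → Subset M) → Decidable P → ∀ y₀ → P y₀ →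
            ∃ λ y → P y × ∀ z → P z → f y ⊄ f z
⊂-maximal {P = P} f P? y₀ Py₀ = go Py₀ (⊃-wellFounded (f y₀))
  where
  go : ∀ {y} → P y → Acc _⊃_ (f y) → ∃ λ y → P y × ∀ z → P z → f y ⊄ f z
  go {y} Py (acc larger) with anySubset? (λ z → P? z ×-dec f y ⊂? f z)
  ... | yes (z , Pz , fy⊂fz) = go Pz (larger fy⊂fz)
  ... | no  none             = y , Py , λ z Pz fy⊂fz → none (z , Pz , fy⊂fz)

module _ (G : Graph) where

  private
    variable
      e e′ : Fin (m G)
      u u′ v v′ : Fin (n G)

  Joins-sym : Joins G e u v → Joins G e v u
  Joins-sym = Sum.swap

  joins-same-edge : Joins G e u v → Joins G e u′ v′ → (u ≡ u′ × v ≡ v′) ⊎ (u ≡ v′ × v ≡ u′)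
  joins-same-edge (inj₁ uv) (inj₁ uv′) = inj₁ (,-injective (trans (sym uv) uv′))
  joins-same-edge (inj₁ uv) (inj₂ vu′) = inj₂ (,-injective (trans (sym uv) vu′))
  joins-same-edge (inj₂ vu) (inj₁ uv′) = inj₂ (Product.swap (,-injective (trans (sym vu) uv′)))
  joins-same-edge (inj₂ vu) (inj₂ vu′) = inj₁ (Product.swap (,-injective (trans (sym vu) vu′)))

  no-loop : Simple G → ¬ Joins G e u u
  no-loop (loopless , _) (inj₁ uu) = loopless _ (trans (cong proj₁ uu) (sym (cong proj₂ uu)))
  no-loop (loopless , _) (inj₂ uu) = loopless _ (trans (cong proj₁ uu) (sym (cong proj₂ uu)))

  joins-unique : Simple G → Joins G e u v → Joins G e′ u v → e ≡ e′
  joins-unique (_ , parallel-free) (inj₁ uv) e′-uv =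
    parallel-free _ _ (subst (λ (a , b) → Joins G _ a b) (sym uv) e′-uv)
  joins-unique (_ , parallel-free) (inj₂ vu) e′-uv =
    parallel-free _ _ (subst (λ (a , b) → Joins G _ a b) (sym vu) (Joins-sym e′-uv))

  -- The degree of v in e modulo 2: a loop is counted twice, hence not at all.
  incident : Fin (n G) → Fin (m G) → Bool
  incident v e = does (proj₁ (ends G e) ≟ v) xor does (proj₂ (ends G e) ≟ v)

  incident-joins : Joins G e u v′ → incident v e ≡ does (u ≟ v) xor does (v′ ≟ v)
  incident-joins (inj₁ uv′) rewrite uv′ = refl
  incident-joins {u = u} {v′ = v′} {v = v} (inj₂ v′u) rewrite v′u =
    xor-comm (does (v′ ≟ v)) (does (u ≟ v))

  incident-end : Simple G → Joins G e u v → incident v e ≡ true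
  incident-end {e = e} {u = u} {v = v} simple uv = begin
    incident v e
      ≡⟨ incident-joins uv ⟩
    does (u ≟ v) xor does (v ≟ v)
      ≡⟨ cong₂ _xor_ (dec-false (u ≟ v) u≢v) (dec-true (v ≟ v) refl) ⟩
    true
      ∎
    where
    open ≡-Reasoning
    u≢v : u ≢ v
    u≢v refl = no-loop simple uv

  incident⇒joins : incident v e ≡ true → ∃ (Joins G e v)
  incident⇒joins {v = v} {e = e} = endpoint (ends G e) refl
    where
    endpoint : ∀ ab → ends G e ≡ ab → does (proj₁ ab ≟ v) xor does (proj₂ ab ≟ v) ≡ true →
               ∃ (Joins G e v)
    endpoint (a , b) ends≡ab odd with a ≟ v | b ≟ v
    ... | yes refl | _        = b , inj₁ ends≡ab
    ... | no _     | yes refl = a , inj₂ ends≡ab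
    ... | no _     | no _     = contradiction odd λ ()

  Even : Subset (m G) → Set
  Even H = ∀ v → parity H (incident v) ≡ false

  Even? : Decidable Even
  Even? H = all? λ v → parity H (incident v) Bool.≟ false

  Even-⊥ : Even ⊥
  Even-⊥ v = parity-⊥ (incident v)

  Even-Δ : ∀ {H K} → Even H → Even K → Even (H Δ K)
  Even-Δ {H} {K} H-even K-even v =
    trans (parity-Δ H K (incident v)) (cong₂ _xor_ (H-even v) (K-even v))

  Even-─ : ∀ {H K} → K ⊆ H → Even H → Even K → Even (H ─ K)
  Even-─ {H} {K} K⊆H H-even K-even v =
    trans (parity-─ H K (incident v) K⊆H) (cong₂ _xor_ (H-even v) (K-even v))

  edge∈cycleEdges : (C : Cycle G) → ∀ t → edge C t ∈ cycleEdges C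
  edge∈cycleEdges C t = x∈⋃⁅xs⁆⁺ (∈-tabulate⁺ {f = edge C} t)

  cycleEdges-⊆ : ∀ {H} (C : Cycle G) → (∀ t → edge C t ∈ H) → cycleEdges C ⊆ H
  cycleEdges-⊆ C edges∈H x∈C with t , refl ← ∈-tabulate⁻ {f = edge C} (x∈⋃⁅xs⁆⁻ _ x∈C) =
    edges∈H t

  cycle-edge-injective : (C : Cycle G) → Injective _≡_ _≡_ (edge C)
  cycle-edge-injective C {s} {t} es≡et
    with joins-same-edge (joins C s) (subst (λ e → Joins G e _ _) (sym es≡et) (joins C t))
  ... | inj₁ (vs≡vt , _)         = vtx-inj C vs≡vt
  ... | inj₂ (vs≡vt⁺ , vs⁺≡vt) =
    contradiction (trans (cong next (sym (vtx-inj C vs≡vt⁺))) (vtx-inj C vs⁺≡vt))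
                  (next²≢id (≤-pred (long C)) t)

  Even-cycleEdges : (C : Cycle G) → Even (cycleEdges C)
  Even-cycleEdges C v = begin
    parity (cycleEdges C) (incident v)
      ≡⟨ parity-⋃⁅⁆ (tabulate (edge C)) (incident v) (Unique.tabulate⁺ (cycle-edge-injective C)) ⟩
    xorAll (map (incident v) (tabulate (edge C)))
      ≡⟨ cong xorAll (map-tabulate (edge C) (incident v)) ⟩
    xorAll (tabulate (incident v ∘ edge C))
      ≡⟨ cong xorAll (tabulate-cong λ t → incident-joins {v = v} (joins C t)) ⟩
    xorAll (tabulate λ t → is-v t xor is-v (next t))
      ≡⟨ xorAll-cyclic is-v ⟩
    false
      ∎
    where
    open ≡-Reasoning
    is-v : Fin (suc (k C)) → Bool
    is-v t = does (vtx C t ≟ v)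

  record Walk : Set where
    field
      vertexAt        : ℕ → Fin (n G)
      edgeAt          : ℕ → Fin (m G)
      edgeAt-joins    : ∀ j → Joins G (edgeAt j) (vertexAt j) (vertexAt (suc j))
      no-backtracking : ∀ j → edgeAt (suc j) ≢ edgeAt j

  open Walk

  drop : ℕ → Walk → Walk
  drop i w = record
    { vertexAt        = λ j → vertexAt w (j + i)
    ; edgeAt          = λ j → edgeAt w (j + i)
    ; edgeAt-joins    = λ j → edgeAt-joins w (j + i)
    ; no-backtracking = λ j → no-backtracking w (j + i)
    }

  closed-walk-length : Simple G → (w : Walk) → ∀ K → vertexAt w (suc K) ≡ vertexAt w 0 →
                       3 ≤ suc K
  closed-walk-length simple w zero closed =
    contradiction (subst (Joins G _ _) closed (edgeAt-joins w 0)) (no-loop simple)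
  closed-walk-length simple w (suc zero) closed =
    contradiction (joins-unique simple (edgeAt-joins w 0) back) (no-backtracking w 0 ∘ sym)
    where
    back : Joins G (edgeAt w 1) (vertexAt w 0) (vertexAt w 1)
    back = Joins-sym (subst (Joins G _ _) closed (edgeAt-joins w 1))
  closed-walk-length simple w (suc (suc K)) closed = s≤s (s≤s (s≤s z≤n))

  closed-walk⇒cycle : Simple G → (w : Walk) → ∀ K → vertexAt w (suc K) ≡ vertexAt w 0 →
                      Injective _≡_ _≡_ (λ (t : Fin (suc K)) → vertexAt w (toℕ t)) →
                      Σ (Cycle G) λ C → ∀ t → edge C t ≡ edgeAt w (toℕ t)
  closed-walk⇒cycle simple w K closed distinct = C , λ _ → refl
    where
    W : ℕ → Fin (n G)
    W = vertexAt w
    wraps : ∀ t → W (suc (toℕ t)) ≡ W (toℕ (next t))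
    wraps t with next-cases t
    ... | inj₁ (_ , t⁺)       = cong W (sym t⁺)
    ... | inj₂ (t≡K , t⁺≡0) = trans (cong (W ∘ suc) t≡K) (trans closed (cong W (sym t⁺≡0)))
    C : Cycle G
    C = record
      { k       = K
      ; long    = closed-walk-length simple w K closed
      ; vtx     = W ∘ toℕ
      ; vtx-inj = distinct
      ; edge    = edgeAt w ∘ toℕ
      ; joins   = λ t → subst (Joins G _ _) (wraps t) (edgeAt-joins w (toℕ t))
      }

  Repeats : Walk → ℕ → Set
  Repeats w j = ∃ λ (i : Fin j) → vertexAt w (toℕ i) ≡ vertexAt w j

  repeats? : ∀ w → Decidable (Repeats w)
  repeats? w j = any? λ i → vertexAt w (toℕ i) ≟ vertexAt w j

  some-repeat : ∀ w → ∃ (Repeats w)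
  some-repeat w with i , j , i<j , Wi≡Wj ← pigeonhole (n<1+n (n G)) (vertexAt w ∘ toℕ) =
    toℕ j , fromℕ< i<j , trans (cong (vertexAt w) (toℕ-fromℕ< i<j)) Wi≡Wj

  first-repeat⇒cycle : Simple G → ∀ w {j} → Repeats w j → (∀ {h} → h < j → ¬ Repeats w h) →
                       Σ (Cycle G) λ C → ∀ t → ∃ λ l → edge C t ≡ edgeAt w l
  first-repeat⇒cycle simple w {j} (i , Wi≡Wj) first =
    Product.map₂ (λ edges t → toℕ t + toℕ i , edges t)
                 (closed-walk⇒cycle simple (drop (toℕ i) w) K closed distinct)
    where
    K : ℕ
    K = j ∸ suc (toℕ i)
    K+1+i≡j : suc K + toℕ i ≡ j
    K+1+i≡j = trans (sym (+-suc K (toℕ i))) (m∸n+n≡m (toℕ<n i))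
    closed : vertexAt w (suc K + toℕ i) ≡ vertexAt w (toℕ i)
    closed = trans (cong (vertexAt w) K+1+i≡j) (sym Wi≡Wj)
    distinct-before-j : ∀ {a b} → a < b → b < j → vertexAt w a ≢ vertexAt w b
    distinct-before-j a<b b<j Wa≡Wb =
      first b<j (fromℕ< a<b , trans (cong (vertexAt w) (toℕ-fromℕ< a<b)) Wa≡Wb)
    distinct : Injective _≡_ _≡_ (λ (t : Fin (suc K)) → vertexAt w (toℕ t + toℕ i))
    distinct = distinct-below⇒injective (λ a → vertexAt w (a + toℕ i)) λ {a} {b} a<b b≤K →
      distinct-before-j (+-monoˡ-< (toℕ i) a<b)
                        (subst (b + toℕ i <_) K+1+i≡j (+-monoˡ-< (toℕ i) b≤K))

  walk⇒cycle : Simple G → ∀ {H} (w : Walk) → (∀ j → edgeAt w j ∈ H) →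
               Σ (Cycle G) λ C → cycleEdges C ⊆ H
  walk⇒cycle simple w edges∈H
    with _ , repeat , first ← least-witness (repeats? w) (proj₂ (some-repeat w))
    with C , on-walk ← first-repeat⇒cycle simple w repeat first =
    C , cycleEdges-⊆ C λ t → let l , Ct≡ = on-walk t in subst (_∈ _) (sym Ct≡) (edges∈H l)

  another-incident-edge : ∀ {H d v} → Even H → d ∈ H → incident v d ≡ true →
                          ∃ λ e → e ∈ H × e ≢ d × incident v e ≡ true
  another-incident-edge {H} {d} {v} H-even d∈H v∈d =
    Product.map₂ (λ (e∈H─d , v∈e) → p─q⊆p H ⁅ d ⁆ e∈H─d ,
                                    x∉⁅y⁆⇒x≢y (x∈p─q⇒x∉q H ⁅ d ⁆ e∈H─d) , v∈e)
                 (parity≡true⇒∃ (H ─ ⁅ d ⁆) (incident v) odd)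
    where
    ⁅d⁆⊆H : ⁅ d ⁆ ⊆ H
    ⁅d⁆⊆H x∈⁅d⁆ = subst (_∈ H) (sym (x∈⁅y⁆⇒x≡y d x∈⁅d⁆)) d∈H
    odd : parity (H ─ ⁅ d ⁆) (incident v) ≡ true
    odd = begin
      parity (H ─ ⁅ d ⁆) (incident v)
        ≡⟨ parity-─ H ⁅ d ⁆ (incident v) ⁅d⁆⊆H ⟩
      parity H (incident v) xor parity ⁅ d ⁆ (incident v)
        ≡⟨ cong₂ _xor_ (H-even v) (parity-⁅⁆ d (incident v)) ⟩
      incident v d
        ≡⟨ v∈d ⟩
      true
        ∎
      where open ≡-Reasoning

  module _ (simple : Simple G) {H : Subset (m G)} (H-even : Even H) where

    record Arrival : Set where
      field
        at     : Fin (n G)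
        via    : Fin (m G)
        via∈H  : via ∈ H
        at-via : incident at via ≡ true

    open Arrival

    record Departure (a : Arrival) : Set where
      field
        arrival   : Arrival
        fresh     : via arrival ≢ via a
        traverses : Joins G (via arrival) (at a) (at arrival)

    open Departure

    depart : (a : Arrival) → Departure a
    depart a with e , e∈H , e≢via , at∈e ← another-incident-edge H-even (via∈H a) (at-via a)
                 with y , at-e-y ← incident⇒joins at∈e = record
      { arrival   = record { at = y ; via = e ; via∈H = e∈H ; at-via = incident-end simple at-e-y }
      ; fresh     = e≢via
      ; traverses = at-e-y
      }

    arrivals : Arrival → ℕ → Arrival
    arrivals a zero    = a
    arrivals a (suc j) = arrival (depart (arrivals a j))

    walk-from : Arrival → Walk
    walk-from a = record
      { vertexAt        = at ∘ arrivals a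
      ; edgeAt          = via ∘ arrivals a ∘ suc
      ; edgeAt-joins    = traverses ∘ depart ∘ arrivals a
      ; no-backtracking = fresh ∘ depart ∘ arrivals a ∘ suc
      }

    even-set-cycle : Nonempty H → Σ (Cycle G) λ C → cycleEdges C ⊆ H
    even-set-cycle (e , e∈H) = walk⇒cycle simple (walk-from start) (via∈H ∘ arrivals start ∘ suc)
      where
      start : Arrival
      start = record
        { at = proj₂ (ends G e) ; via = e ; via∈H = e∈H ; at-via = incident-end simple (inj₁ refl) }

  record CycleDecomposition (H : Subset (m G)) : Set where
    field
      cycles        : List (Cycle G)
      edge-disjoint : EdgeDisjoint cycles
      within        : All (λ C → cycleEdges C ⊆ H) cycles
      covers        : H ⊆ collEdges cycles

  open CycleDecomposition

  empty-decomposition : ∀ {H} → Empty H → CycleDecomposition H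
  empty-decomposition H-empty = record
    { cycles        = []
    ; edge-disjoint = AllPairs.[]
    ; within        = All.[]
    ; covers        = λ x∈H → contradiction (_ , x∈H) H-empty
    }

  cons-decomposition : ∀ {H} (C : Cycle G) → cycleEdges C ⊆ H →
                       CycleDecomposition (H ─ cycleEdges C) → CycleDecomposition H
  cons-decomposition {H} C C⊆H D = record
    { cycles        = C ∷ cycles D
    ; edge-disjoint = All.map (λ D⊆H─C x x∈C x∈D → x∈p─q⇒x∉q H _ (D⊆H─C x∈D) x∈C) (within D)
                      AllPairs.∷ edge-disjoint D
    ; within        = C⊆H All.∷ All.map (λ D⊆H─C {x} x∈D → p─q⊆p H _ (D⊆H─C x∈D)) (within D)
    ; covers        = covers′
    }
    where
    covers′ : H ⊆ cycleEdges C ∪ collEdges (cycles D)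
    covers′ {x} x∈H with x ∈? cycleEdges C
    ... | yes x∈C = x∈p∪q⁺ (inj₁ x∈C)
    ... | no  x∉C = x∈p∪q⁺ (inj₂ (covers D (x∈p∧x∉q⇒x∈p─q x∈H x∉C)))

  H─C⊂H : ∀ {H} (C : Cycle G) → cycleEdges C ⊆ H → H ─ cycleEdges C ⊂ H
  H─C⊂H {H} C C⊆H = p∩q≢∅⇒p─q⊂p H (cycleEdges C) (edge C zero , x∈p∩q⁺ (C⊆H C₀∈C , C₀∈C))
    where
    C₀∈C : edge C zero ∈ cycleEdges C
    C₀∈C = edge∈cycleEdges C zero

  decompose : Simple G → ∀ {H} → Even H → CycleDecomposition H
  decompose simple {H} H-even = go H-even (⊂-wellFounded H)
    where
    go : ∀ {H} → Even H → Acc _⊂_ H → CycleDecomposition H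
    go {H} H-even (acc smaller) with nonempty? H
    ... | no  H-empty    = empty-decomposition H-empty
    ... | yes H-nonempty = let C , C⊆H = even-set-cycle simple H-even H-nonempty in
      cons-decomposition C C⊆H
        (go (Even-─ C⊆H H-even (Even-cycleEdges C)) (smaller (H─C⊂H C C⊆H)))

  maximal-even-hits-F-cycles : ∀ {F H} → Even H → (∀ H′ → Even H′ → F ∩ H ⊄ F ∩ H′) →
                               HitsAllFCycles {G} F (F ∩ H)
  maximal-even-hits-F-cycles {F} {H} H-even maximal C F-cycle
    with nonempty? ((F ∩ H) ∩ cycleEdges C)
  ... | yes hit  = hit
  ... | no  miss = contradiction (p∩q⊂p∩[qΔr] F H (cycleEdges C) miss F-cycle)
                     (maximal (H Δ cycleEdges C) (Even-Δ {H} H-even (Even-cycleEdges C)))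

theorem2p1 : (G : Graph) → Simple G → (F : Subset (m G)) →
  Σ (List (Cycle G)) λ 𝒞 → Σ (Subset (m G)) λ Y →
    EdgeDisjoint {G} 𝒞 × HitsAllFCycles {G} F Y × ∣ F ∩ collEdges {G} 𝒞 ∣ ≥ ∣ Y ∣
theorem2p1 G simple F
  with H , H-even , H-maximal ← ⊂-maximal (F ∩_) (Even? G) ⊥ (Even-⊥ G) =
  let D = decompose G simple H-even in
  cycles D , F ∩ H , edge-disjoint D , maximal-even-hits-F-cycles G H-even H-maximal ,
  p⊆q⇒∣p∣≤∣q∣ (p∩q⊆p∩r F H _ (covers D))
  where open CycleDecomposition
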